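{- Let $t\ge 3$ be an integer and let $W$ be a symmetric $(4t,4(t-1))$-weighing matrix whose diagonal $4\times 4$ blocks are all zero. Let $W'$ be the $8t\times 8t$ matrix obtained from $W$ by replacing each entry $0$ by $O_2$, each $1$ by $I_2$, and each $-1$ by $J_2-I_2$, and let $$M_0=I_{8t},\ M_1=I_{4t}\otimes(J_2-I_2),\ M_2=I_t\otimes\big((J_4-I_4)\otimes J_2\big),\ M_3=W',\ M_4=J_{8t}-M_0-M_1-M_2-M_3.$$ Let $V=\{1,\dots,8t\}$, $s_i=\{(x,y)\in V^2:(M_i)_{xy}=1\}$, let $n_i$ be the number of ones in a row of $M_i$, and let $c_{ij}^k$ be the intersection numbers of the association scheme $(V,\{s_0,\dots,s_4\})$. Then: (1) $c_{33}^3=c_{33}^4$; (2) $\frac{n_2}{n_1+1}-\frac{2n_3}{n_4}=1$ and $\frac{n_2}{n_1+1}-\frac{2n_4}{n_3}=1$; (3) $\frac{1}{n_3}+\frac{1}{n_4}\neq\frac{1}{n_1}-\frac{1}{n_1+1}$.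
   Context: An $(n,k)$-weighing matrix is an $n\times n$ $\{0,1,-1\}$-matrix $W$ with $WW^T=kI_n$; $I_n,J_n,O_n$ are the identity, all-ones and zero matrices; $\otimes$ is the Kronecker product. For a symmetric association scheme with basis relations $s_0,\dots,s_4$, $c_{ij}^k=|\{z:(x,z)\in s_i,(z,y)\in s_j\}|$ for any $(x,y)\in s_k$ (independent of the choice). -}

module Defs where

open import Data.Nat as ℕ using (ℕ; zero; suc; _<_; _≡ᵇ_)
open import Data.Nat.DivMod using (_/_; _%_)
open import Data.Integer as ℤ using (ℤ; +_; -[1+_]; _≟_)
open import Data.Rational as ℚ using (ℚ; 0ℚ)
open import Data.Bool using (Bool; true; false; if_then_else_; not)
open import Data.Sum using (_⊎_)
open import Data.Fin using (Fin; toℕ)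
open import Relation.Nullary using (does)
open import Relation.Binary.PropositionalEquality using (_≡_)

-- Matrices are represented as functions ℕ → ℕ → ℤ; only the entries with
-- indices below the stated size are meaningful.
Mat : Set
Mat = ℕ → ℕ → ℤ

sumℤ : ℕ → (ℕ → ℤ) → ℤ
sumℤ zero    f = + 0
sumℤ (suc n) f = sumℤ n f ℤ.+ f n

sumℕ : ℕ → (ℕ → ℕ) → ℕ
sumℕ zero    f = 0
sumℕ (suc n) f = sumℕ n f ℕ.+ f n

ind : Bool → ℤ
ind true  = + 1
ind false = + 0

Iₘ : Mat
Iₘ i j = ind (i ≡ᵇ j)

Jₘ : Mat
Jₘ i j = + 1

Oₘ : Mat
Oₘ i j = + 0

_+ₘ_ : Mat → Mat → Mat
(A +ₘ B) i j = A i j ℤ.+ B i j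

_-ₘ_ : Mat → Mat → Mat
(A -ₘ B) i j = A i j ℤ.- B i j

infixl 6 _+ₘ_ _-ₘ_

kron : (p q : ℕ) .{{_ : ℕ.NonZero p}} .{{_ : ℕ.NonZero q}} → Mat → Mat → Mat
kron p q A B i j = A (i / p) (j / q) ℤ.* B (i % p) (j % q)

IsSignMatrix : ℕ → Mat → Set
IsSignMatrix n W = ∀ i j → i < n → j < n →
  (W i j ≡ + 0) ⊎ (W i j ≡ + 1) ⊎ (W i j ≡ -[1+ 0 ])

IsWeighing : ℕ → ℕ → Mat → Set
IsWeighing n k W = IsSignMatrix n W ×' (∀ i j → i < n → j < n →
  sumℤ n (λ l → W i l ℤ.* W j l) ≡ (+ k) ℤ.* Iₘ i j)
  where open import Data.Product renaming (_×_ to _×'_)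

IsSymmetric : ℕ → Mat → Set
IsSymmetric n W = ∀ i j → i < n → j < n → W i j ≡ W j i

DiagBlocksZero : ℕ → Mat → Set
DiagBlocksZero n W = ∀ i j → i < n → j < n → i / 4 ≡ j / 4 → W i j ≡ + 0

blockOf : ℤ → Mat
blockOf (+ 0)      = Oₘ
blockOf (+ 1)      = Iₘ
blockOf -[1+ 0 ]   = Jₘ -ₘ Iₘ
blockOf _          = Oₘ   -- never used for {0,±1}-matrices

W′ : Mat → Mat
W′ W x y = blockOf (W (x / 2) (y / 2)) (x % 2) (y % 2)

M : ℕ → Mat → Fin 5 → Mat
M t W i = go (toℕ i)
  where
  M0 M1 M2 M3 : Mat
  M0 = Iₘ
  M1 = kron 2 2 Iₘ (Jₘ -ₘ Iₘ)
  M2 = kron 8 8 Iₘ (kron 2 2 (Jₘ -ₘ Iₘ) Jₘ)         -- I_t ⊗ ((J₄ - I₄) ⊗ J₂)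
  M3 = W′ W
  go : ℕ → Mat
  go 0 = M0
  go 1 = M1
  go 2 = M2
  go 3 = M3
  go _ = Jₘ -ₘ M0 -ₘ M1 -ₘ M2 -ₘ M3

isOne : ℤ → ℕ
isOne z = if does (z ≟ + 1) then 1 else 0

rowOnes : ℕ → Mat → Fin 5 → ℕ → ℕ
rowOnes t W i x = sumℕ (8 ℕ.* t) (λ y → isOne (M t W i x y))

interNum : ℕ → Mat → Fin 5 → Fin 5 → ℕ → ℕ → ℕ
interNum t W i j x y =
  sumℕ (8 ℕ.* t) (λ z → isOne (M t W i x z) ℕ.* isOne (M t W j z y))

InRel : ℕ → Mat → Fin 5 → ℕ → ℕ → Set
InRel t W i x y = M t W i x y ≡ + 1

-- rational a / b, with the convention a / 0 = 0 (never triggered here)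
frac : ℕ → ℕ → ℚ
frac a zero    = 0ℚ
frac a (suc b) = (+ a) ℚ./ suc b

module Submission where

-- Write t = s + 1. A row of W has 4s entries ±1 and four zeros in its diagonal block, so every entry
-- outside the diagonal blocks is ±1. Reading M₁ and M₂ as Kronecker products gives n₁ = 1 and
-- n₂ = 3 · 2 = 6; an entry ±1 of W puts one 1 into each row of its 2 × 2 block, so n₃ = 4s, and as
-- M₀ + ⋯ + M₄ = J, n₄ = 8t − 8 − 4s = 4s. This gives (2), and (3) because 4s ≠ 4.
-- Pairs in s₃ or s₄ lie in different diagonal blocks. Entry (p, q) of blockOf w is
-- (∣ w ∣ + w σ p σ q) / 2, so at such a pair (x, y) twice c₃₃ is the number of common nonzero
-- positions of the rows x / 2 and y / 2 of W, which is 4s − 4, plus σ p σ q times their inner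
-- product, which is 0.

open import Defs
open import Data.Nat as ℕ using (ℕ; zero; suc; _≤_; _<_; _*_; _∸_; _+_; z≤n; s≤s; NonZero)
open import Data.Nat.Properties
open import Data.Nat.DivMod
open import Data.Nat.Divisibility using (n∣m*n)
open import Data.Integer as ℤ using (ℤ; +_; -[1+_]; ∣_∣)
import Data.Integer.Properties as ℤ
open import Data.Rational as ℚ using (1ℚ; toℚᵘ)
open import Data.Rational.Properties using (toℚᵘ-fromℚᵘ; toℚᵘ-injective; fromℚᵘ-cong; toℚᵘ-homo-+)
open import Data.Rational.Unnormalised as ℚᵘ using (mkℚᵘ; *≡*; _≃_)
import Data.Rational.Unnormalised.Properties as ℚᵘ
open import Data.Fin using (Fin; #_)
open import Data.Product using (_×_; _,_; proj₁; proj₂)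
open import Data.Bool using (true; false)
open import Data.Empty using (⊥-elim)
open import Data.Sum using (_⊎_; inj₁; inj₂)
open import Function using (_∘_)
open import Relation.Nullary using (yes; no)
open import Relation.Nullary.Decidable using (dec-true; dec-false)
open import Relation.Binary.PropositionalEquality
import Algebra.Properties.CommutativeSemigroup as CommutativeSemigroupProperties
open CommutativeSemigroupProperties +-commutativeSemigroup using (interchange)
open CommutativeSemigroupProperties ℤ.+-commutativeSemigroup using ()
  renaming (interchange to ℤ-interchange)
open ≡-Reasoning

module _ {k : ℕ} .{{_ : NonZero k}} {r m : ℕ} (r<k : r < k) where

  [r+m*k]/k≡m : (r + m * k) / k ≡ m
  [r+m*k]/k≡m = trans (+-distrib-/-∣ʳ r (n∣m*n m)) (cong₂ _+_ (m<n⇒m/n≡0 r<k) (m*n/n≡m m k))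

  [r+m*k]%k≡r : (r + m * k) % k ≡ r
  [r+m*k]%k≡r = trans ([m+kn]%n≡m%n r m k) (m<n⇒m%n≡m r<k)

/8≡/2/4 : ∀ x → x / 8 ≡ x / 2 / 4
/8≡/2/4 x = sym (m/n/o≡m/[n*o] x 2 4)

%8/2≡/2%4 : ∀ x → x % 8 / 2 ≡ x / 2 % 4
%8/2≡/2%4 x = m%[n*o]/o≡m/o%n x 4 2

/%-injective : ∀ {k} .{{_ : NonZero k}} {x y} → x / k ≡ y / k → x % k ≡ y % k → x ≡ y
/%-injective {k} {x} {y} x/k≡y/k x%k≡y%k = begin
  x                  ≡⟨ m≡m%n+[m/n]*n x k ⟩
  x % k + x / k * k  ≡⟨ cong₂ (λ r q → r + q * k) x%k≡y%k x/k≡y/k ⟩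
  y % k + y / k * k  ≡⟨ m≡m%n+[m/n]*n y k ⟨
  y                  ∎

-- Finite sums

sumℕ-cong : ∀ n {f g : ℕ → ℕ} → (∀ {i} → i < n → f i ≡ g i) → sumℕ n f ≡ sumℕ n g
sumℕ-cong zero    f≗g = refl
sumℕ-cong (suc n) f≗g = cong₂ _+_ (sumℕ-cong n (f≗g ∘ m<n⇒m<1+n)) (f≗g (n<1+n n))

sumℤ-cong : ∀ n {f g : ℕ → ℤ} → (∀ {i} → i < n → f i ≡ g i) → sumℤ n f ≡ sumℤ n g
sumℤ-cong zero    f≗g = refl
sumℤ-cong (suc n) f≗g = cong₂ ℤ._+_ (sumℤ-cong n (f≗g ∘ m<n⇒m<1+n)) (f≗g (n<1+n n))

sumℕ-+ : ∀ n (f g : ℕ → ℕ) → sumℕ n (λ i → f i + g i) ≡ sumℕ n f + sumℕ n g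
sumℕ-+ zero    f g = refl
sumℕ-+ (suc n) f g = trans (cong (_+ (f n + g n)) (sumℕ-+ n f g))
                           (interchange (sumℕ n f) (sumℕ n g) (f n) (g n))

sumℤ-+ : ∀ n (f g : ℕ → ℤ) → sumℤ n (λ i → f i ℤ.+ g i) ≡ sumℤ n f ℤ.+ sumℤ n g
sumℤ-+ zero    f g = refl
sumℤ-+ (suc n) f g = trans (cong (ℤ._+ (f n ℤ.+ g n)) (sumℤ-+ n f g))
                           (ℤ-interchange (sumℤ n f) (sumℤ n g) (f n) (g n))

sumℕ-const : ∀ n c → sumℕ n (λ _ → c) ≡ n * c
sumℕ-const zero    c = refl
sumℕ-const (suc n) c = trans (cong (_+ c) (sumℕ-const n c)) (+-comm (n * c) c)

sumℕ-zero : ∀ n {f : ℕ → ℕ} → (∀ {i} → i < n → f i ≡ 0) → sumℕ n f ≡ 0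
sumℕ-zero n f≗0 = trans (sumℕ-cong n f≗0) (trans (sumℕ-const n 0) (*-zeroʳ n))

sumℕ-*ˡ : ∀ n k (f : ℕ → ℕ) → sumℕ n (λ i → k * f i) ≡ k * sumℕ n f
sumℕ-*ˡ zero    k f = sym (*-zeroʳ k)
sumℕ-*ˡ (suc n) k f = trans (cong (_+ k * f n) (sumℕ-*ˡ n k f))
                            (sym (*-distribˡ-+ k (sumℕ n f) (f n)))

sumℕ-*ʳ : ∀ n k (f : ℕ → ℕ) → sumℕ n (λ i → f i * k) ≡ sumℕ n f * k
sumℕ-*ʳ zero    k f = refl
sumℕ-*ʳ (suc n) k f = trans (cong (_+ f n * k) (sumℕ-*ʳ n k f))
                            (sym (*-distribʳ-+ k (sumℕ n f) (f n)))

sumℤ-*ʳ : ∀ n k (f : ℕ → ℤ) → sumℤ n (λ i → f i ℤ.* k) ≡ sumℤ n f ℤ.* k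
sumℤ-*ʳ zero    k f = refl
sumℤ-*ʳ (suc n) k f = trans (cong (ℤ._+ f n ℤ.* k) (sumℤ-*ʳ n k f))
                            (sym (ℤ.*-distribʳ-+ k (sumℤ n f) (f n)))

pos-sumℕ : ∀ n (f : ℕ → ℕ) → + sumℕ n f ≡ sumℤ n (+_ ∘ f)
pos-sumℕ zero    f = refl
pos-sumℕ (suc n) f = trans (ℤ.pos-+ (sumℕ n f) (f n)) (cong (ℤ._+ + f n) (pos-sumℕ n f))

sumℕ-split : ∀ m n (f : ℕ → ℕ) → sumℕ (m + n) f ≡ sumℕ m f + sumℕ n (λ i → f (i + m))
sumℕ-split m zero    f = trans (cong (λ k → sumℕ k f) (+-identityʳ m)) (sym (+-identityʳ _))
sumℕ-split m (suc n) f = begin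
  sumℕ (m + suc n) f                                     ≡⟨ cong (λ k → sumℕ k f) (+-suc m n) ⟩
  sumℕ (m + n) f + f (m + n)                             ≡⟨ cong₂ _+_ (sumℕ-split m n f) (cong f (+-comm m n)) ⟩
  sumℕ m f + sumℕ n (λ i → f (i + m)) + f (n + m)        ≡⟨ +-assoc (sumℕ m f) _ _ ⟩
  sumℕ m f + (sumℕ n (λ i → f (i + m)) + f (n + m))      ∎

sumℕ-/% : ∀ m k .{{_ : NonZero k}} (G : ℕ → ℕ → ℕ) →
  sumℕ (m * k) (λ y → G (y / k) (y % k)) ≡ sumℕ m (λ b → sumℕ k (G b))
sumℕ-/% zero    k G = refl
sumℕ-/% (suc m) k G = begin
  sumℕ (k + m * k) F                                    ≡⟨ cong (λ n → sumℕ n F) (+-comm k (m * k)) ⟩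
  sumℕ (m * k + k) F                                    ≡⟨ sumℕ-split (m * k) k F ⟩
  sumℕ (m * k) F + sumℕ k (λ r → F (r + m * k))         ≡⟨ cong₂ _+_ (sumℕ-/% m k G) (sumℕ-cong k λ r<k →
                                                             cong₂ G ([r+m*k]/k≡m {m = m} r<k) ([r+m*k]%k≡r {m = m} r<k)) ⟩
  sumℕ m (λ b → sumℕ k (G b)) + sumℕ k (G m)            ∎
  where
  F : ℕ → ℕ
  F y = G (y / k) (y % k)

sumℕ-≤ : ∀ n {f : ℕ → ℕ} {c} → (∀ {i} → i < n → f i ≤ c) → sumℕ n f ≤ n * c
sumℕ-≤ zero    f≤c = z≤n
sumℕ-≤ (suc n) {f} {c} f≤c = subst (sumℕ n f + f n ≤_) (+-comm (n * c) c)
  (+-mono-≤ (sumℕ-≤ n (f≤c ∘ m<n⇒m<1+n)) (f≤c (n<1+n n)))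

+-tight : ∀ {a b A B} → a ≤ A → b ≤ B → a + b ≡ A + B → a ≡ A × b ≡ B
+-tight {a} {b} {A} {B} a≤A b≤B a+b≡A+B = a≡A , +-cancelˡ-≡ A b B (subst (λ z → z + b ≡ A + B) a≡A a+b≡A+B)
  where
  a≡A : a ≡ A
  a≡A = ≤-antisym a≤A (+-cancelʳ-≤ B A a (subst (_≤ a + B) a+b≡A+B (+-monoʳ-≤ a b≤B)))

sumℕ-tight : ∀ n {f : ℕ → ℕ} {c} → (∀ {i} → i < n → f i ≤ c) → sumℕ n f ≡ n * c →
             ∀ {i} → i < n → f i ≡ c
sumℕ-tight (suc n) {f} {c} f≤c sum≡ i<1+n
  with +-tight (sumℕ-≤ n (f≤c ∘ m<n⇒m<1+n)) (f≤c (n<1+n n)) (trans sum≡ (+-comm c (n * c)))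
     | m<1+n⇒m<n∨m≡n i<1+n
... | prefix≡ , _    | inj₁ i<n  = sumℕ-tight n (f≤c ∘ m<n⇒m<1+n) prefix≡ i<n
... | _      , last≡ | inj₂ refl = last≡

Iₘ-≡ : ∀ {i j} → i ≡ j → Iₘ i j ≡ + 1
Iₘ-≡ {i} {j} i≡j = cong ind (dec-true (i ℕ.≟ j) i≡j)

Iₘ-≢ : ∀ {i j} → i ≢ j → Iₘ i j ≡ + 0
Iₘ-≢ {i} {j} i≢j = cong ind (dec-false (i ℕ.≟ j) i≢j)

J-I-≡ : ∀ {i j} → i ≡ j → (Jₘ -ₘ Iₘ) i j ≡ + 0
J-I-≡ i≡j = cong (ℤ._-_ (+ 1)) (Iₘ-≡ i≡j)

J-I-≢ : ∀ {i j} → i ≢ j → (Jₘ -ₘ Iₘ) i j ≡ + 1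
J-I-≢ i≢j = cong (ℤ._-_ (+ 1)) (Iₘ-≢ i≢j)

sumℕ-sift : ∀ {n i} (f : ℕ → ℕ) → i < n → sumℕ n (λ j → isOne (Iₘ i j) * f j) ≡ f i
sumℕ-sift {suc n} {i} f i<1+n with m<1+n⇒m<n∨m≡n i<1+n
... | inj₁ i<n = begin
  sumℕ n (λ j → isOne (Iₘ i j) * f j) + isOne (Iₘ i n) * f n ≡⟨ cong₂ _+_ (sumℕ-sift f i<n)
                                                                   (cong (λ u → isOne u * f n) (Iₘ-≢ (<⇒≢ i<n))) ⟩
  f i + 0                                                   ≡⟨ +-identityʳ (f i) ⟩
  f i                                                       ∎
... | inj₂ refl = begin
  sumℕ i (λ j → isOne (Iₘ i j) * f j) + isOne (Iₘ i i) * f i ≡⟨ cong₂ _+_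
      (sumℕ-zero i λ j<i → cong (λ u → isOne u * f _) (Iₘ-≢ (>⇒≢ j<i)))
      (cong (λ u → isOne u * f i) (Iₘ-≡ {i} refl)) ⟩
  0 + 1 * f i                                                ≡⟨ *-identityˡ (f i) ⟩
  f i                                                        ∎

IsZeroOne : Mat → Set
IsZeroOne A = ∀ i j → A i j ≡ + 0 ⊎ A i j ≡ + 1

Iₘ-zeroOne : IsZeroOne Iₘ
Iₘ-zeroOne i j with i ℕ.≡ᵇ j
... | false = inj₁ refl
... | true  = inj₂ refl

J-I-zeroOne : IsZeroOne (Jₘ -ₘ Iₘ)
J-I-zeroOne i j with i ℕ.≡ᵇ j
... | true  = inj₁ refl
... | false = inj₂ refl

isOne-* : ∀ {u} v → u ≡ + 0 ⊎ u ≡ + 1 → isOne (u ℤ.* v) ≡ isOne u * isOne v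
isOne-* v (inj₁ refl) = refl
isOne-* v (inj₂ refl) = trans (cong isOne (ℤ.*-identityˡ v)) (sym (*-identityˡ (isOne v)))

isOne-complement : ∀ {u} → u ≡ + 0 ⊎ u ≡ + 1 → isOne (+ 1 ℤ.- u) + isOne u ≡ 1
isOne-complement (inj₁ refl) = refl
isOne-complement (inj₂ refl) = refl

module _ {k : ℕ} .{{_ : NonZero k}} {x y : ℕ} where

  kron-Iₘ-≡ : ∀ {B} → x / k ≡ y / k → kron k k Iₘ B x y ≡ B (x % k) (y % k)
  kron-Iₘ-≡ {B} x~y = trans (cong (ℤ._* B (x % k) (y % k)) (Iₘ-≡ x~y)) (ℤ.*-identityˡ _)

  kron-Iₘ-≢ : ∀ {B} → x / k ≢ y / k → kron k k Iₘ B x y ≡ + 0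
  kron-Iₘ-≢ {B} x≁y = cong (ℤ._* B (x % k) (y % k)) (Iₘ-≢ x≁y)

  kron-Jₘ : ∀ {l} .{{_ : NonZero l}} {A} → kron k l A Jₘ x y ≡ A (x / k) (y / l)
  kron-Jₘ = ℤ.*-identityʳ _

onesIn : ℕ → Mat → ℕ → ℕ
onesIn n A i = sumℕ n (λ j → isOne (A i j))

onesIn-Iₘ : ∀ {n i} → i < n → onesIn n Iₘ i ≡ 1
onesIn-Iₘ {n} {i} i<n = trans (sumℕ-cong n λ _ → sym (*-identityʳ _)) (sumℕ-sift (λ _ → 1) i<n)

onesIn-Jₘ : ∀ n i → onesIn n Jₘ i ≡ n
onesIn-Jₘ n i = trans (sumℕ-const n 1) (*-identityʳ n)

onesIn-J-I : ∀ {n i} → i < n → onesIn n (Jₘ -ₘ Iₘ) i ≡ n ∸ 1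
onesIn-J-I {n} {i} i<n = begin
  onesIn n (Jₘ -ₘ Iₘ) i                                  ≡⟨ m+n∸n≡m _ 1 ⟨
  onesIn n (Jₘ -ₘ Iₘ) i + 1 ∸ 1                          ≡⟨ cong (λ c → onesIn n (Jₘ -ₘ Iₘ) i + c ∸ 1) (onesIn-Iₘ i<n) ⟨
  onesIn n (Jₘ -ₘ Iₘ) i + onesIn n Iₘ i ∸ 1              ≡⟨ cong (_∸ 1) (sumℕ-+ n _ _) ⟨
  sumℕ n (λ j → isOne ((Jₘ -ₘ Iₘ) i j) + isOne (Iₘ i j)) ∸ 1
    ≡⟨ cong (_∸ 1) (sumℕ-cong n λ {j} _ → isOne-complement (Iₘ-zeroOne i j)) ⟩
  onesIn n Jₘ i ∸ 1                                      ≡⟨ cong (_∸ 1) (onesIn-Jₘ n i) ⟩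
  n ∸ 1                                                  ∎

onesIn-kron : ∀ m k .{{_ : NonZero k}} {A} B → IsZeroOne A → ∀ x →
  onesIn (m * k) (kron k k A B) x ≡ onesIn m A (x / k) * onesIn k B (x % k)
onesIn-kron m k {A} B A-01 x = begin
  onesIn (m * k) (kron k k A B) x
    ≡⟨ sumℕ-/% m k (λ b r → isOne (A (x / k) b ℤ.* B (x % k) r)) ⟩
  sumℕ m (λ b → sumℕ k (λ r → isOne (A (x / k) b ℤ.* B (x % k) r)))
    ≡⟨ sumℕ-cong m (λ {b} _ → sumℕ-cong k λ {r} _ → isOne-* (B (x % k) r) (A-01 (x / k) b)) ⟩
  sumℕ m (λ b → sumℕ k (λ r → isOne (A (x / k) b) * isOne (B (x % k) r)))
    ≡⟨ sumℕ-cong m (λ {b} _ → sumℕ-*ˡ k (isOne (A (x / k) b)) _) ⟩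
  sumℕ m (λ b → isOne (A (x / k) b) * onesIn k B (x % k))
    ≡⟨ sumℕ-*ʳ m _ _ ⟩
  onesIn m A (x / k) * onesIn k B (x % k)
    ∎

I⊗J₄ : Mat
I⊗J₄ = kron 4 4 Iₘ Jₘ

isOne-I⊗J₄-≡ : ∀ {a c} → a / 4 ≡ c / 4 → isOne (I⊗J₄ a c) ≡ 1
isOne-I⊗J₄-≡ {a} {c} a~c = cong isOne (kron-Iₘ-≡ {k = 4} {x = a} {y = c} {B = Jₘ} a~c)

isOne-I⊗J₄-≢ : ∀ {a c} → a / 4 ≢ c / 4 → isOne (I⊗J₄ a c) ≡ 0
isOne-I⊗J₄-≢ {a} {c} a≁c = cong isOne (kron-Iₘ-≢ {k = 4} {x = a} {y = c} {B = Jₘ} a≁c)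

-- Sign matrices and their 2 × 2 blocks

IsSign : ℤ → Set
IsSign w = (w ≡ + 0) ⊎ (w ≡ + 1) ⊎ (w ≡ -[1+ 0 ])

pattern is0  = inj₁ refl
pattern is+1 = inj₂ (inj₁ refl)
pattern is-1 = inj₂ (inj₂ refl)

pattern 0<2 = s≤s z≤n
pattern 1<2 = s≤s (s≤s z≤n)

∣sign∣≤1 : ∀ {w} → IsSign w → ∣ w ∣ ≤ 1
∣sign∣≤1 is0  = z≤n
∣sign∣≤1 is+1 = ≤-refl
∣sign∣≤1 is-1 = ≤-refl

sign*sign : ∀ {w} → IsSign w → w ℤ.* w ≡ + ∣ w ∣
sign*sign is0  = refl
sign*sign is+1 = refl
sign*sign is-1 = refl

onesIn-blockOf : ∀ {w p} → IsSign w → p < 2 → onesIn 2 (blockOf w) p ≡ ∣ w ∣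
onesIn-blockOf is0  _   = refl
onesIn-blockOf is+1 0<2 = refl
onesIn-blockOf is+1 1<2 = refl
onesIn-blockOf is-1 0<2 = refl
onesIn-blockOf is-1 1<2 = refl

blockOf-zeroOne : ∀ {w} → w ≡ + 1 ⊎ w ≡ -[1+ 0 ] → IsZeroOne (blockOf w)
blockOf-zeroOne (inj₁ refl) = Iₘ-zeroOne
blockOf-zeroOne (inj₂ refl) = J-I-zeroOne

blockProduct : ℤ → ℤ → ℕ → ℕ → ℕ
blockProduct v w p q = sumℕ 2 (λ r → isOne (blockOf v p r) * isOne (blockOf w r q))

σ : ℕ → ℤ
σ zero    = + 1
σ (suc _) = -[1+ 0 ]

-- For a sign w, entry (p, q) of blockOf w is (∣ w ∣ + w σ p σ q) / 2.
blockProduct-formula : ∀ {v w p q} → IsSign v → IsSign w → p < 2 → q < 2 →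
  + (2 * blockProduct v w p q) ≡ + (∣ v ∣ * ∣ w ∣) ℤ.+ v ℤ.* w ℤ.* (σ p ℤ.* σ q)
blockProduct-formula is0  _    _   _   = refl
blockProduct-formula is+1 is0  0<2 _   = refl
blockProduct-formula is+1 is0  1<2 _   = refl
blockProduct-formula is-1 is0  0<2 _   = refl
blockProduct-formula is-1 is0  1<2 _   = refl
blockProduct-formula is+1 is+1 0<2 0<2 = refl
blockProduct-formula is+1 is+1 0<2 1<2 = refl
blockProduct-formula is+1 is+1 1<2 0<2 = refl
blockProduct-formula is+1 is+1 1<2 1<2 = refl
blockProduct-formula is+1 is-1 0<2 0<2 = refl
blockProduct-formula is+1 is-1 0<2 1<2 = refl
blockProduct-formula is+1 is-1 1<2 0<2 = refl
blockProduct-formula is+1 is-1 1<2 1<2 = refl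
blockProduct-formula is-1 is+1 0<2 0<2 = refl
blockProduct-formula is-1 is+1 0<2 1<2 = refl
blockProduct-formula is-1 is+1 1<2 0<2 = refl
blockProduct-formula is-1 is+1 1<2 1<2 = refl
blockProduct-formula is-1 is-1 0<2 0<2 = refl
blockProduct-formula is-1 is-1 0<2 1<2 = refl
blockProduct-formula is-1 is-1 1<2 0<2 = refl
blockProduct-formula is-1 is-1 1<2 1<2 = refl

sumℕ-blockProduct : ∀ n {u v : ℕ → ℤ} {p q} →
  (∀ {d} → d < n → IsSign (u d)) → (∀ {d} → d < n → IsSign (v d)) → p < 2 → q < 2 →
  + (2 * sumℕ n (λ d → blockProduct (u d) (v d) p q))
    ≡ + sumℕ n (λ d → ∣ u d ∣ * ∣ v d ∣) ℤ.+ sumℤ n (λ d → u d ℤ.* v d) ℤ.* (σ p ℤ.* σ q)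
sumℕ-blockProduct n {u} {v} {p} {q} u± v± p<2 q<2 = begin
  + (2 * sumℕ n (λ d → blockProduct (u d) (v d) p q))
    ≡⟨ cong +_ (sumℕ-*ˡ n 2 _) ⟨
  + sumℕ n (λ d → 2 * blockProduct (u d) (v d) p q)
    ≡⟨ pos-sumℕ n _ ⟩
  sumℤ n (λ d → + (2 * blockProduct (u d) (v d) p q))
    ≡⟨ sumℤ-cong n (λ d<n → blockProduct-formula (u± d<n) (v± d<n) p<2 q<2) ⟩
  sumℤ n (λ d → + (∣ u d ∣ * ∣ v d ∣) ℤ.+ u d ℤ.* v d ℤ.* (σ p ℤ.* σ q))
    ≡⟨ sumℤ-+ n _ _ ⟩
  sumℤ n (λ d → + (∣ u d ∣ * ∣ v d ∣)) ℤ.+ sumℤ n (λ d → u d ℤ.* v d ℤ.* (σ p ℤ.* σ q))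
    ≡⟨ cong₂ ℤ._+_ (sym (pos-sumℕ n _)) (sumℤ-*ʳ n _ _) ⟩
  + sumℕ n (λ d → ∣ u d ∣ * ∣ v d ∣) ℤ.+ sumℤ n (λ d → u d ℤ.* v d) ℤ.* (σ p ℤ.* σ q)
    ∎

onesIn-W′ : ∀ {n W x} → IsSignMatrix n W → x / 2 < n →
  onesIn (n * 2) (W′ W) x ≡ sumℕ n (λ b → ∣ W (x / 2) b ∣)
onesIn-W′ {n} {W} {x} sign a<n = begin
  onesIn (n * 2) (W′ W) x                       ≡⟨ sumℕ-/% n 2 (λ b r → isOne (blockOf (W (x / 2) b) (x % 2) r)) ⟩
  sumℕ n (λ b → onesIn 2 (blockOf (W (x / 2) b)) (x % 2))
    ≡⟨ sumℕ-cong n (λ b<n → onesIn-blockOf (sign _ _ a<n b<n) (m%n<n x 2)) ⟩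
  sumℕ n (λ b → ∣ W (x / 2) b ∣)                ∎

module _ {n k W} (weighing : IsWeighing n k W) where

  weighing-rowWeight : ∀ {i} → i < n → sumℕ n (λ j → ∣ W i j ∣) ≡ k
  weighing-rowWeight {i} i<n = ℤ.+-injective (begin
    + sumℕ n (λ j → ∣ W i j ∣)        ≡⟨ pos-sumℕ n _ ⟩
    sumℤ n (λ j → + ∣ W i j ∣)        ≡⟨ sumℤ-cong n (λ j<n → sign*sign (proj₁ weighing i _ i<n j<n)) ⟨
    sumℤ n (λ j → W i j ℤ.* W i j)    ≡⟨ proj₂ weighing i i i<n i<n ⟩
    + k ℤ.* Iₘ i i                    ≡⟨ cong (+ k ℤ.*_) (Iₘ-≡ {i} refl) ⟩
    + k ℤ.* + 1                       ≡⟨ ℤ.*-identityʳ (+ k) ⟩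
    + k                               ∎)

  weighing-orthogonal : IsSymmetric n W → ∀ {i j} → i < n → j < n → i ≢ j →
    sumℤ n (λ l → W i l ℤ.* W l j) ≡ + 0
  weighing-orthogonal symmetric {i} {j} i<n j<n i≢j = begin
    sumℤ n (λ l → W i l ℤ.* W l j)    ≡⟨ sumℤ-cong n (λ l<n → cong (W i _ ℤ.*_) (symmetric _ j l<n j<n)) ⟩
    sumℤ n (λ l → W i l ℤ.* W j l)    ≡⟨ proj₂ weighing i j i<n j<n ⟩
    + k ℤ.* Iₘ i j                    ≡⟨ cong (+ k ℤ.*_) (Iₘ-≢ i≢j) ⟩
    + k ℤ.* + 0                       ≡⟨ ℤ.*-zeroʳ (+ k) ⟩
    + 0                               ∎

toℚᵘ-frac : ∀ a m → toℚᵘ (frac a (suc m)) ≃ mkℚᵘ (+ a) m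
toℚᵘ-frac a m = toℚᵘ-fromℚᵘ (mkℚᵘ (+ a) m)

frac-cross : ∀ {a m b n} → frac a (suc m) ≡ frac b (suc n) → a * suc n ≡ b * suc m
frac-cross {a} {m} {b} {n} a/m≡b/n
  with ℚᵘ.≃-trans (ℚᵘ.≃-sym (toℚᵘ-frac a m)) (ℚᵘ.≃-trans (ℚᵘ.≃-reflexive (cong toℚᵘ a/m≡b/n)) (toℚᵘ-frac b n))
... | *≡* cross = ℤ.+-injective (trans (ℤ.pos-* a (suc n)) (trans cross (sym (ℤ.pos-* b (suc m)))))

frac-cross⁻¹ : ∀ {a m b n} → a * suc n ≡ b * suc m → frac a (suc m) ≡ frac b (suc n)
frac-cross⁻¹ {a} {m} {b} {n} cross =
  fromℚᵘ-cong {mkℚᵘ (+ a) m} {mkℚᵘ (+ b) n}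
    (*≡* (trans (sym (ℤ.pos-* a (suc n))) (trans (cong +_ cross) (ℤ.pos-* b (suc m)))))

frac-+ : ∀ a b m → frac a (suc m) ℚ.+ frac b (suc m) ≡ frac (a + b) (suc m)
frac-+ a b m = toℚᵘ-injective
  (ℚᵘ.≃-trans (toℚᵘ-homo-+ (frac a (suc m)) (frac b (suc m)))
  (ℚᵘ.≃-trans (ℚᵘ.+-cong (toℚᵘ-frac a m) (toℚᵘ-frac b m))
  (ℚᵘ.≃-trans (*≡* common-denominator)
              (ℚᵘ.≃-sym (toℚᵘ-frac (a + b) m)))))
  where
  d : ℤ
  d = + suc m
  common-denominator : (+ a ℤ.* d ℤ.+ + b ℤ.* d) ℤ.* d ≡ + (a + b) ℤ.* + (suc m * suc m)
  common-denominator = begin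
    (+ a ℤ.* d ℤ.+ + b ℤ.* d) ℤ.* d   ≡⟨ cong (ℤ._* d) (ℤ.*-distribʳ-+ d (+ a) (+ b)) ⟨
    (+ a ℤ.+ + b) ℤ.* d ℤ.* d         ≡⟨ ℤ.*-assoc (+ a ℤ.+ + b) d d ⟩
    (+ a ℤ.+ + b) ℤ.* (d ℤ.* d)       ≡⟨ cong₂ ℤ._*_ (ℤ.pos-+ a b) (ℤ.pos-* (suc m) (suc m)) ⟨
    + (a + b) ℤ.* + (suc m * suc m)   ∎

valency-ratios : ∀ {m n₁ n₂ n₃ n₄} → suc m ≢ 4 → n₁ ≡ 1 → n₂ ≡ 6 → n₃ ≡ suc m → n₄ ≡ suc m →
  ((frac n₂ (n₁ + 1) ℚ.- frac (2 * n₃) n₄ ≡ 1ℚ) × (frac n₂ (n₁ + 1) ℚ.- frac (2 * n₄) n₃ ≡ 1ℚ))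
  × (frac 1 n₃ ℚ.+ frac 1 n₄ ≢ frac 1 n₁ ℚ.- frac 1 (n₁ + 1))
valency-ratios {m} n≢4 refl refl refl refl = (6/2-2n/n≡1 , 6/2-2n/n≡1) , 2/n≢1/2 ∘ trans (sym (frac-+ 1 1 m))
  where
  6/2-2n/n≡1 : frac 6 2 ℚ.- frac (2 * suc m) (suc m) ≡ 1ℚ
  6/2-2n/n≡1 = cong (ℚ._-_ (frac 6 2)) (frac-cross⁻¹ {2 * suc m} {m} {2} {0} (*-identityʳ (2 * suc m)))
  2/n≢1/2 : frac 2 (suc m) ≢ frac 1 2
  2/n≢1/2 2/n≡1/2 = n≢4 (sym (trans (frac-cross {2} {m} {1} {1} 2/n≡1/2) (*-identityˡ (suc m))))

-- The association scheme

data ExactlyOne (u₀ u₁ u₂ u₃ : ℤ) : Set where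
  only₀ : u₀ ≡ + 1 → u₁ ≡ + 0 → u₂ ≡ + 0 → u₃ ≡ + 0 → ExactlyOne u₀ u₁ u₂ u₃
  only₁ : u₀ ≡ + 0 → u₁ ≡ + 1 → u₂ ≡ + 0 → u₃ ≡ + 0 → ExactlyOne u₀ u₁ u₂ u₃
  only₂ : u₀ ≡ + 0 → u₁ ≡ + 0 → u₂ ≡ + 1 → u₃ ≡ + 0 → ExactlyOne u₀ u₁ u₂ u₃
  only₃ : u₀ ≡ + 0 → u₁ ≡ + 0 → u₂ ≡ + 0 → u₃ ≡ + 1 → ExactlyOne u₀ u₁ u₂ u₃

complement : ℤ → ℤ → ℤ → ℤ → ℤ
complement u₀ u₁ u₂ u₃ = + 1 ℤ.- u₀ ℤ.- u₁ ℤ.- u₂ ℤ.- u₃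

onesAmong : ℤ → ℤ → ℤ → ℤ → ℕ
onesAmong u₀ u₁ u₂ u₃ = isOne u₀ + isOne u₁ + isOne u₂ + isOne u₃ + isOne (complement u₀ u₁ u₂ u₃)

exactlyOne-complement : ∀ {u₀ u₁ u₂ u₃} → ExactlyOne u₀ u₁ u₂ u₃ → complement u₀ u₁ u₂ u₃ ≡ + 0
exactlyOne-complement (only₀ refl refl refl refl) = refl
exactlyOne-complement (only₁ refl refl refl refl) = refl
exactlyOne-complement (only₂ refl refl refl refl) = refl
exactlyOne-complement (only₃ refl refl refl refl) = refl

exactlyOne-onesAmong : ∀ {u₀ u₁ u₂ u₃} → ExactlyOne u₀ u₁ u₂ u₃ → onesAmong u₀ u₁ u₂ u₃ ≡ 1
exactlyOne-onesAmong (only₀ refl refl refl refl) = refl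
exactlyOne-onesAmong (only₁ refl refl refl refl) = refl
exactlyOne-onesAmong (only₂ refl refl refl refl) = refl
exactlyOne-onesAmong (only₃ refl refl refl refl) = refl

onesAmong-zeros : ∀ {u₀ u₁ u₂ u₃} → u₀ ≡ + 0 → u₁ ≡ + 0 → u₂ ≡ + 0 → u₃ ≡ + 0 → onesAmong u₀ u₁ u₂ u₃ ≡ 1
onesAmong-zeros refl refl refl refl = refl

module Scheme (s : ℕ) (W : Mat) (weighing : IsWeighing (4 * suc s) (4 * s) W)
              (symmetric : IsSymmetric (4 * suc s) W) (zeroBlocks : DiagBlocksZero (4 * suc s) W) where

  t : ℕ
  t = suc s

  sign : ∀ {a c} → a < 4 * t → c < 4 * t → IsSign (W a c)
  sign = proj₁ weighing _ _

  8t≡4t*2 : 8 * t ≡ 4 * t * 2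
  8t≡4t*2 = trans (*-assoc 2 4 t) (*-comm 2 (4 * t))

  -- Vertex x lies in row x / 2 of W, at position x % 2 of the 2 × 2 blocks; x / 2 / 4 indexes its
  -- diagonal block.
  half< : ∀ {x} → x < 8 * t → x / 2 < 4 * t
  half< {x} x< = m<n*o⇒m/o<n (subst (x <_) 8t≡4t*2 x<)

  onesIn-I⊗J₄ : ∀ {a} → a < 4 * t → onesIn (4 * t) I⊗J₄ a ≡ 4
  onesIn-I⊗J₄ {a} a< = begin
    onesIn (4 * t) I⊗J₄ a                     ≡⟨ cong (λ n → onesIn n I⊗J₄ a) (*-comm 4 t) ⟩
    onesIn (t * 4) I⊗J₄ a                     ≡⟨ onesIn-kron t 4 Jₘ Iₘ-zeroOne a ⟩
    onesIn t Iₘ (a / 4) * onesIn 4 Jₘ (a % 4)  ≡⟨ cong₂ _*_ (onesIn-Iₘ (m<n*o⇒m/o<n {n = t} {o = 4} (subst (a <_) (*-comm 4 t) a<)))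
                                                            (onesIn-Jₘ 4 (a % 4)) ⟩
    4                                         ∎

  ∣W∣+I⊗J₄≡1 : ∀ {a c} → a < 4 * t → c < 4 * t → ∣ W a c ∣ + isOne (I⊗J₄ a c) ≡ 1
  ∣W∣+I⊗J₄≡1 {a} a< = sumℕ-tight (4 * t) bounded total
    where
    bounded : ∀ {c} → c < 4 * t → ∣ W a c ∣ + isOne (I⊗J₄ a c) ≤ 1
    bounded {c} c< with a / 4 ℕ.≟ c / 4
    ... | yes a~c = ≤-reflexive (cong₂ _+_ (cong ∣_∣ (zeroBlocks a c a< c< a~c)) (isOne-I⊗J₄-≡ {a} {c} a~c))
    ... | no a≁c  = ≤-trans (≤-reflexive (trans (cong (_+_ ∣ W a c ∣) (isOne-I⊗J₄-≢ {a} {c} a≁c)) (+-identityʳ _)))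
                            (∣sign∣≤1 (sign a< c<))
    total : sumℕ (4 * t) (λ c → ∣ W a c ∣ + isOne (I⊗J₄ a c)) ≡ 4 * t * 1
    total = begin
      sumℕ (4 * t) (λ c → ∣ W a c ∣ + isOne (I⊗J₄ a c))     ≡⟨ sumℕ-+ (4 * t) _ _ ⟩
      sumℕ (4 * t) (λ c → ∣ W a c ∣) + onesIn (4 * t) I⊗J₄ a ≡⟨ cong₂ _+_ (weighing-rowWeight weighing a<) (onesIn-I⊗J₄ a<) ⟩
      4 * s + 4                                              ≡⟨ +-comm (4 * s) 4 ⟩
      4 + 4 * s                                              ≡⟨ *-suc 4 s ⟨
      4 * t                                                  ≡⟨ *-identityʳ (4 * t) ⟨
      4 * t * 1                                              ∎

  ∣W∣-offBlock : ∀ {a c} → a < 4 * t → c < 4 * t → a / 4 ≢ c / 4 → ∣ W a c ∣ ≡ 1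
  ∣W∣-offBlock {a} {c} a< c< a≁c = begin
    ∣ W a c ∣                       ≡⟨ +-identityʳ _ ⟨
    ∣ W a c ∣ + 0                   ≡⟨ cong (_+_ ∣ W a c ∣) (isOne-I⊗J₄-≢ {a} {c} a≁c) ⟨
    ∣ W a c ∣ + isOne (I⊗J₄ a c)    ≡⟨ ∣W∣+I⊗J₄≡1 a< c< ⟩
    1                               ∎

  W-offBlock : ∀ {a c} → a < 4 * t → c < 4 * t → a / 4 ≢ c / 4 → W a c ≡ + 1 ⊎ W a c ≡ -[1+ 0 ]
  W-offBlock a< c< a≁c with sign a< c<
  ... | inj₁ w≡0  = ⊥-elim (0≢1+n (trans (cong ∣_∣ (sym w≡0)) (∣W∣-offBlock a< c< a≁c)))
  ... | inj₂ w≡±1 = w≡±1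

  commonSupport : ∀ {a b} → a < 4 * t → b < 4 * t → a / 4 ≢ b / 4 →
    sumℕ (4 * t) (λ d → ∣ W a d ∣ * ∣ W d b ∣) + 4 ≡ 4 * s
  commonSupport {a} {b} a< b< a≁b = begin
    sumℕ (4 * t) (λ d → ∣ W a d ∣ * ∣ W d b ∣) + 4
      ≡⟨ cong (_+_ (sumℕ (4 * t) (λ d → ∣ W a d ∣ * ∣ W d b ∣))) (onesIn-I⊗J₄ b<) ⟨
    sumℕ (4 * t) (λ d → ∣ W a d ∣ * ∣ W d b ∣) + onesIn (4 * t) I⊗J₄ b
      ≡⟨ sumℕ-+ (4 * t) _ _ ⟨
    sumℕ (4 * t) (λ d → ∣ W a d ∣ * ∣ W d b ∣ + isOne (I⊗J₄ b d))
      ≡⟨ sumℕ-cong (4 * t) split ⟩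
    sumℕ (4 * t) (λ d → ∣ W a d ∣)
      ≡⟨ weighing-rowWeight weighing a< ⟩
    4 * s
      ∎
    where
    split : ∀ {d} → d < 4 * t → ∣ W a d ∣ * ∣ W d b ∣ + isOne (I⊗J₄ b d) ≡ ∣ W a d ∣
    split {d} d< with b / 4 ℕ.≟ d / 4
    ... | yes b~d = begin
      ∣ W a d ∣ * ∣ W d b ∣ + isOne (I⊗J₄ b d)
        ≡⟨ cong₂ (λ u v → u * ∣ v ∣ + isOne (I⊗J₄ b d))
                 (∣W∣-offBlock a< d< (a≁b ∘ λ a~d → trans a~d (sym b~d)))
                 (zeroBlocks d b d< b< (sym b~d)) ⟩
      isOne (I⊗J₄ b d)
        ≡⟨ isOne-I⊗J₄-≡ {b} {d} b~d ⟩
      1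
        ≡⟨ ∣W∣-offBlock a< d< (a≁b ∘ λ a~d → trans a~d (sym b~d)) ⟨
      ∣ W a d ∣
        ∎
    ... | no b≁d = begin
      ∣ W a d ∣ * ∣ W d b ∣ + isOne (I⊗J₄ b d)
        ≡⟨ cong₂ (λ u v → ∣ W a d ∣ * u + v) (∣W∣-offBlock d< b< (b≁d ∘ sym)) (isOne-I⊗J₄-≢ {b} {d} b≁d) ⟩
      ∣ W a d ∣ * 1 + 0
        ≡⟨ trans (+-identityʳ _) (*-identityʳ _) ⟩
      ∣ W a d ∣
        ∎

  rowOnes₀ : ∀ {x} → x < 8 * t → rowOnes t W (# 0) x ≡ 1
  rowOnes₀ = onesIn-Iₘ

  rowOnes₁ : ∀ {x} → x < 8 * t → rowOnes t W (# 1) x ≡ 1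
  rowOnes₁ {x} x< = begin
    onesIn (8 * t) (kron 2 2 Iₘ (Jₘ -ₘ Iₘ)) x                ≡⟨ cong (λ n → onesIn n (kron 2 2 Iₘ (Jₘ -ₘ Iₘ)) x) 8t≡4t*2 ⟩
    onesIn (4 * t * 2) (kron 2 2 Iₘ (Jₘ -ₘ Iₘ)) x            ≡⟨ onesIn-kron (4 * t) 2 (Jₘ -ₘ Iₘ) Iₘ-zeroOne x ⟩
    onesIn (4 * t) Iₘ (x / 2) * onesIn 2 (Jₘ -ₘ Iₘ) (x % 2)  ≡⟨ cong₂ _*_ (onesIn-Iₘ (half< x<)) (onesIn-J-I (m%n<n x 2)) ⟩
    1                                                       ∎

  rowOnes₂ : ∀ {x} → x < 8 * t → rowOnes t W (# 2) x ≡ 6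
  rowOnes₂ {x} x< = begin
    onesIn (8 * t) (kron 8 8 Iₘ B) x                    ≡⟨ cong (λ n → onesIn n (kron 8 8 Iₘ B) x) (*-comm 8 t) ⟩
    onesIn (t * 8) (kron 8 8 Iₘ B) x                    ≡⟨ onesIn-kron t 8 B Iₘ-zeroOne x ⟩
    onesIn t Iₘ (x / 8) * onesIn (4 * 2) B (x % 8)      ≡⟨ cong (onesIn t Iₘ (x / 8) *_) (onesIn-kron 4 2 Jₘ J-I-zeroOne (x % 8)) ⟩
    onesIn t Iₘ (x / 8) * (onesIn 4 (Jₘ -ₘ Iₘ) (x % 8 / 2) * onesIn 2 Jₘ (x % 8 % 2))
      ≡⟨ cong₂ _*_ (onesIn-Iₘ (m<n*o⇒m/o<n {n = t} {o = 8} (subst (x <_) (*-comm 8 t) x<)))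
                   (cong₂ _*_ (onesIn-J-I (m<n*o⇒m/o<n {n = 4} {o = 2} (m%n<n x 8))) (onesIn-Jₘ 2 (x % 8 % 2))) ⟩
    6                                                   ∎
    where
    B : Mat
    B = kron 2 2 (Jₘ -ₘ Iₘ) Jₘ

  rowOnes₃ : ∀ {x} → x < 8 * t → rowOnes t W (# 3) x ≡ 4 * s
  rowOnes₃ {x} x< = begin
    onesIn (8 * t) (W′ W) x              ≡⟨ cong (λ n → onesIn n (W′ W) x) 8t≡4t*2 ⟩
    onesIn (4 * t * 2) (W′ W) x          ≡⟨ onesIn-W′ {4 * t} {W} {x} (proj₁ weighing) (half< x<) ⟩
    sumℕ (4 * t) (λ b → ∣ W (x / 2) b ∣) ≡⟨ weighing-rowWeight weighing (half< x<) ⟩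
    4 * s                                ∎

  M₁-≡ : ∀ {x y} → x / 2 ≡ y / 2 → M t W (# 1) x y ≡ (Jₘ -ₘ Iₘ) (x % 2) (y % 2)
  M₁-≡ {x} {y} = kron-Iₘ-≡ {k = 2} {x = x} {y = y} {B = Jₘ -ₘ Iₘ}

  M₁-≢ : ∀ {x y} → x / 2 ≢ y / 2 → M t W (# 1) x y ≡ + 0
  M₁-≢ {x} {y} = kron-Iₘ-≢ {k = 2} {x = x} {y = y} {B = Jₘ -ₘ Iₘ}

  M₂-≢ : ∀ {x y} → x / 8 ≢ y / 8 → M t W (# 2) x y ≡ + 0
  M₂-≢ {x} {y} = kron-Iₘ-≢ {k = 8} {x = x} {y = y} {B = kron 2 2 (Jₘ -ₘ Iₘ) Jₘ}

  M₂-sameBlock : ∀ {x y} → x / 2 / 4 ≡ y / 2 / 4 → M t W (# 2) x y ≡ (Jₘ -ₘ Iₘ) (x / 2 % 4) (y / 2 % 4)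
  M₂-sameBlock {x} {y} x~y = begin
    kron 8 8 Iₘ (kron 2 2 (Jₘ -ₘ Iₘ) Jₘ) x y  ≡⟨ kron-Iₘ-≡ {k = 8} {x = x} {y = y} {B = kron 2 2 (Jₘ -ₘ Iₘ) Jₘ} (trans (/8≡/2/4 x) (trans x~y (sym (/8≡/2/4 y)))) ⟩
    kron 2 2 (Jₘ -ₘ Iₘ) Jₘ (x % 8) (y % 8)    ≡⟨ kron-Jₘ {k = 2} {x = x % 8} {y = y % 8} {l = 2} {A = Jₘ -ₘ Iₘ} ⟩
    (Jₘ -ₘ Iₘ) (x % 8 / 2) (y % 8 / 2)        ≡⟨ cong₂ (Jₘ -ₘ Iₘ) (%8/2≡/2%4 x) (%8/2≡/2%4 y) ⟩
    (Jₘ -ₘ Iₘ) (x / 2 % 4) (y / 2 % 4)        ∎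

  M₃-sameBlock : ∀ {x y} → x < 8 * t → y < 8 * t → x / 2 / 4 ≡ y / 2 / 4 → M t W (# 3) x y ≡ + 0
  M₃-sameBlock {x} {y} x< y< x~y =
    cong (λ w → blockOf w (x % 2) (y % 2)) (zeroBlocks _ _ (half< x<) (half< y<) x~y)

  sameBlock-exactlyOne : ∀ {x y} → x < 8 * t → y < 8 * t → x / 2 / 4 ≡ y / 2 / 4 →
    ExactlyOne (M t W (# 0) x y) (M t W (# 1) x y) (M t W (# 2) x y) (M t W (# 3) x y)
  sameBlock-exactlyOne {x} {y} x< y< x~y with x ℕ.≟ y | x / 2 ℕ.≟ y / 2
  ... | yes refl | _ =
    only₀ (Iₘ-≡ {x} {x} refl) (trans (M₁-≡ {x} {x} refl) (J-I-≡ {x % 2} refl))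
          (trans (M₂-sameBlock {x} {x} x~y) (J-I-≡ {x / 2 % 4} refl)) (M₃-sameBlock x< y< x~y)
  ... | no x≢y | yes x/2≡y/2 =
    only₁ (Iₘ-≢ {x} {y} x≢y) (trans (M₁-≡ {x} {y} x/2≡y/2) (J-I-≢ (x≢y ∘ /%-injective x/2≡y/2)))
          (trans (M₂-sameBlock {x} {y} x~y) (J-I-≡ (cong (_% 4) x/2≡y/2))) (M₃-sameBlock x< y< x~y)
  ... | no x≢y | no x/2≢y/2 =
    only₂ (Iₘ-≢ {x} {y} x≢y) (M₁-≢ {x} {y} x/2≢y/2)
          (trans (M₂-sameBlock {x} {y} x~y) (J-I-≢ (x/2≢y/2 ∘ /%-injective x~y))) (M₃-sameBlock x< y< x~y)

  offBlock-M₀₁₂ : ∀ {x y} → x / 2 / 4 ≢ y / 2 / 4 →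
    M t W (# 0) x y ≡ + 0 × M t W (# 1) x y ≡ + 0 × M t W (# 2) x y ≡ + 0
  offBlock-M₀₁₂ {x} {y} x≁y =
    Iₘ-≢ {x} {y} (x≁y ∘ cong (λ z → z / 2 / 4)) ,
    M₁-≢ {x} {y} (x≁y ∘ cong (_/ 4)) ,
    M₂-≢ {x} {y} (x≁y ∘ λ x/8≡y/8 → trans (sym (/8≡/2/4 x)) (trans x/8≡y/8 (/8≡/2/4 y)))

  partition : ∀ {x y} → x < 8 * t → y < 8 * t →
    onesAmong (M t W (# 0) x y) (M t W (# 1) x y) (M t W (# 2) x y) (M t W (# 3) x y) ≡ 1
  partition {x} {y} x< y< with x / 2 / 4 ℕ.≟ y / 2 / 4
  ... | yes x~y = exactlyOne-onesAmong (sameBlock-exactlyOne x< y< x~y)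
  ... | no x≁y with offBlock-M₀₁₂ {x} {y} x≁y | blockOf-zeroOne (W-offBlock (half< x<) (half< y<) x≁y) (x % 2) (y % 2)
  ...   | m₀≡0 , m₁≡0 , m₂≡0 | inj₁ m₃≡0 = onesAmong-zeros m₀≡0 m₁≡0 m₂≡0 m₃≡0
  ...   | m₀≡0 , m₁≡0 , m₂≡0 | inj₂ m₃≡1 = exactlyOne-onesAmong (only₃ m₀≡0 m₁≡0 m₂≡0 m₃≡1)

  rowOnes-sum : ∀ {x} → x < 8 * t →
    rowOnes t W (# 0) x + rowOnes t W (# 1) x + rowOnes t W (# 2) x + rowOnes t W (# 3) x + rowOnes t W (# 4) x
      ≡ 8 * t
  rowOnes-sum {x} x< = begin
    n (# 0) x + n (# 1) x + n (# 2) x + n (# 3) x + n (# 4) x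
      ≡⟨ cong (λ z → z + n (# 2) x + n (# 3) x + n (# 4) x) (sumℕ-+ (8 * t) (m (# 0)) (m (# 1))) ⟨
    sumℕ (8 * t) (λ y → m (# 0) y + m (# 1) y) + n (# 2) x + n (# 3) x + n (# 4) x
      ≡⟨ cong (λ z → z + n (# 3) x + n (# 4) x) (sumℕ-+ (8 * t) _ (m (# 2))) ⟨
    sumℕ (8 * t) (λ y → m (# 0) y + m (# 1) y + m (# 2) y) + n (# 3) x + n (# 4) x
      ≡⟨ cong (_+ n (# 4) x) (sumℕ-+ (8 * t) _ (m (# 3))) ⟨
    sumℕ (8 * t) (λ y → m (# 0) y + m (# 1) y + m (# 2) y + m (# 3) y) + n (# 4) x
      ≡⟨ sumℕ-+ (8 * t) _ (m (# 4)) ⟨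
    sumℕ (8 * t) (λ y → m (# 0) y + m (# 1) y + m (# 2) y + m (# 3) y + m (# 4) y)
      ≡⟨ sumℕ-cong (8 * t) (partition x<) ⟩
    sumℕ (8 * t) (λ _ → 1)
      ≡⟨ trans (sumℕ-const (8 * t) 1) (*-identityʳ (8 * t)) ⟩
    8 * t
      ∎
    where
    n : Fin 5 → ℕ → ℕ
    n = rowOnes t W
    m : Fin 5 → ℕ → ℕ
    m i y = isOne (M t W i x y)

  rowOnes₄ : ∀ {x} → x < 8 * t → rowOnes t W (# 4) x ≡ 4 * s
  rowOnes₄ {x} x< = +-cancelˡ-≡ (8 + 4 * s) _ _ (begin
    8 + 4 * s + rowOnes t W (# 4) x
      ≡⟨ cong (_+ rowOnes t W (# 4) x) otherRows ⟨
    rowOnes t W (# 0) x + rowOnes t W (# 1) x + rowOnes t W (# 2) x + rowOnes t W (# 3) x + rowOnes t W (# 4) x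
      ≡⟨ rowOnes-sum x< ⟩
    8 * t
      ≡⟨ *-suc 8 s ⟩
    8 + (4 + 4) * s
      ≡⟨ cong (_+_ 8) (*-distribʳ-+ s 4 4) ⟩
    8 + (4 * s + 4 * s)
      ≡⟨ +-assoc 8 (4 * s) (4 * s) ⟨
    8 + 4 * s + 4 * s
      ∎)
    where
    otherRows : rowOnes t W (# 0) x + rowOnes t W (# 1) x + rowOnes t W (# 2) x + rowOnes t W (# 3) x ≡ 8 + 4 * s
    otherRows = cong₂ _+_ (cong₂ _+_ (cong₂ _+_ (rowOnes₀ x<) (rowOnes₁ x<)) (rowOnes₂ x<)) (rowOnes₃ x<)

  s₃⇒offBlock : ∀ {x y} → x < 8 * t → y < 8 * t → InRel t W (# 3) x y → x / 2 / 4 ≢ y / 2 / 4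
  s₃⇒offBlock x< y< xy∈s₃ x~y with trans (sym xy∈s₃) (M₃-sameBlock x< y< x~y)
  ... | ()

  s₄⇒offBlock : ∀ {x y} → x < 8 * t → y < 8 * t → InRel t W (# 4) x y → x / 2 / 4 ≢ y / 2 / 4
  s₄⇒offBlock x< y< xy∈s₄ x~y with trans (sym xy∈s₄) (exactlyOne-complement (sameBlock-exactlyOne x< y< x~y))
  ... | ()

  interNum₃₃-offBlock : ∀ {x y} → x < 8 * t → y < 8 * t → x / 2 / 4 ≢ y / 2 / 4 →
    2 * interNum t W (# 3) (# 3) x y + 4 ≡ 4 * s
  interNum₃₃-offBlock {x} {y} x< y< x≁y = begin
    2 * interNum t W (# 3) (# 3) x y + 4                                 ≡⟨ cong (λ c → 2 * c + 4) byBlocks ⟩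
    2 * sumℕ (4 * t) (λ d → blockProduct (W a d) (W d b) p q) + 4       ≡⟨ cong (_+ 4) (ℤ.+-injective twice) ⟩
    sumℕ (4 * t) (λ d → ∣ W a d ∣ * ∣ W d b ∣) + 4                      ≡⟨ commonSupport a< b< x≁y ⟩
    4 * s                                                               ∎
    where
    a b p q : ℕ
    a = x / 2
    b = y / 2
    p = x % 2
    q = y % 2
    a< : a < 4 * t
    a< = half< x<
    b< : b < 4 * t
    b< = half< y<
    byBlocks : interNum t W (# 3) (# 3) x y ≡ sumℕ (4 * t) (λ d → blockProduct (W a d) (W d b) p q)
    byBlocks = trans (cong (λ n → sumℕ n (λ z → isOne (W′ W x z) * isOne (W′ W z y))) 8t≡4t*2)
                     (sumℕ-/% (4 * t) 2 (λ d r → isOne (blockOf (W a d) p r) * isOne (blockOf (W d b) r q)))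
    twice : + (2 * sumℕ (4 * t) (λ d → blockProduct (W a d) (W d b) p q))
            ≡ + sumℕ (4 * t) (λ d → ∣ W a d ∣ * ∣ W d b ∣)
    twice = begin
      + (2 * sumℕ (4 * t) (λ d → blockProduct (W a d) (W d b) p q))
        ≡⟨ sumℕ-blockProduct (4 * t) (sign a<) (λ d< → sign d< b<) (m%n<n x 2) (m%n<n y 2) ⟩
      + sumℕ (4 * t) (λ d → ∣ W a d ∣ * ∣ W d b ∣) ℤ.+ sumℤ (4 * t) (λ d → W a d ℤ.* W d b) ℤ.* (σ p ℤ.* σ q)
        ≡⟨ cong (λ z → + sumℕ (4 * t) (λ d → ∣ W a d ∣ * ∣ W d b ∣) ℤ.+ z ℤ.* (σ p ℤ.* σ q))
                (weighing-orthogonal {k = 4 * s} weighing symmetric a< b< (x≁y ∘ cong (_/ 4))) ⟩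
      + sumℕ (4 * t) (λ d → ∣ W a d ∣ * ∣ W d b ∣) ℤ.+ + 0
        ≡⟨ ℤ.+-identityʳ _ ⟩
      + sumℕ (4 * t) (λ d → ∣ W a d ∣ * ∣ W d b ∣)
        ∎

  interNum₃₃-s₃≡s₄ : ∀ {x y x′ y′} → x < 8 * t → y < 8 * t → x′ < 8 * t → y′ < 8 * t →
    InRel t W (# 3) x y → InRel t W (# 4) x′ y′ →
    interNum t W (# 3) (# 3) x y ≡ interNum t W (# 3) (# 3) x′ y′
  interNum₃₃-s₃≡s₄ x< y< x′< y′< xy∈s₃ x′y′∈s₄ = *-cancelˡ-≡ _ _ 2 (+-cancelʳ-≡ 4 _ _ (trans
    (interNum₃₃-offBlock x< y< (s₃⇒offBlock x< y< xy∈s₃))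
    (sym (interNum₃₃-offBlock x′< y′< (s₄⇒offBlock x′< y′< x′y′∈s₄)))))

lemma5p3 : (t : ℕ) → 3 ≤ t → (W : Mat) →
    IsWeighing (4 * t) (4 * (t ∸ 1)) W →
    IsSymmetric (4 * t) W →
    DiagBlocksZero (4 * t) W →
    -- (1) c_{33}^3 = c_{33}^4
    (∀ x y x′ y′ → x < 8 * t → y < 8 * t → x′ < 8 * t → y′ < 8 * t →
      InRel t W (# 3) x y → InRel t W (# 4) x′ y′ →
      interNum t W (# 3) (# 3) x y ≡ interNum t W (# 3) (# 3) x′ y′)
    × (∀ x → x < 8 * t →
      let n₁ = rowOnes t W (# 1) x
          n₂ = rowOnes t W (# 2) x
          n₃ = rowOnes t W (# 3) x
          n₄ = rowOnes t W (# 4) x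
      in
      -- (2)
      ((frac n₂ (n₁ + 1) ℚ.- frac (2 * n₃) n₄ ≡ 1ℚ)
        × (frac n₂ (n₁ + 1) ℚ.- frac (2 * n₄) n₃ ≡ 1ℚ))
      -- (3)
      × (frac 1 n₃ ℚ.+ frac 1 n₄ ≢ frac 1 n₁ ℚ.- frac 1 (n₁ + 1)))
lemma5p3 (suc s@(suc (suc _))) (s≤s (s≤s (s≤s _))) W weighing symmetric zeroBlocks =
  (λ _ _ _ _ → interNum₃₃-s₃≡s₄) ,
  λ _ x< → valency-ratios 4s≢4 (rowOnes₁ x<) (rowOnes₂ x<) (rowOnes₃ x<) (rowOnes₄ x<)
  where
  open Scheme s W weighing symmetric zeroBlocks
  -- The only use of t ≥ 3: for t = 2 both sides of (3) are 1/2.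
  4s≢4 : 4 * s ≢ 4
  4s≢4 4s≡4 with *-cancelˡ-≡ s 1 4 4s≡4
  ... | ()
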